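{- For each integer $d\geq2$, the set $\mathbb{P}_d=\{p \text{ prime}: p\mid H_d(n)\text{ for some } n\in\mathbb{N}\}$ is infinite.
   Context: $\mathbb{N}$ denotes the non-negative integers. For an integer $d\geq2$ and $n\in\mathbb{N}$, $H_d(n)$ is the number of permutations in $S_n$ that are products of pairwise disjoint $d$-cycles (identity included); equivalently $H_d(n)=1$ for $0\le n\le d-1$ and $H_d(n)=H_d(n-1)+(n-1)(n-2)\cdots(n-d+1)H_d(n-d)$ for $n\ge d$. -}

module Defs where

open import Data.Nat using (ℕ; zero; suc; _+_; _*_; _∸_; _<ᵇ_)
open import Data.Bool using (if_then_else_)

-- fall n d = (n-1)(n-2)...(n-d+1)  (product of d-1 factors n∸i, 1 ≤ i ≤ d-1)
fall : ℕ → ℕ → ℕ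
fall n zero = 1
fall n (suc zero) = 1
fall n (suc (suc k)) = (n ∸ suc k) * fall n (suc k)

-- fuelled version of the recurrence; fuel only guarantees termination
Hfuel : ℕ → ℕ → ℕ → ℕ
Hfuel fuel d n with n <ᵇ d
... | Data.Bool.true = 1
Hfuel zero d n | Data.Bool.false = 1
Hfuel (suc fuel) d n | Data.Bool.false =
  Hfuel fuel d (n ∸ 1) + fall n d * Hfuel fuel d (n ∸ d)

-- H d n : number of permutations of n points that are products of disjoint d-cycles
-- H d n = 1 for n < d; H d n = H d (n-1) + (n-1)...(n-d+1) H d (n-d) for n ≥ d
H : ℕ → ℕ → ℕ
H d n = Hfuel (suc n) d n

-- Choose n with m! ∣ n and H d n > d^((d-1)(n+d-1)); this is possible because H d grows like a
-- power of n!. Expanding H d n = Σₖ C(n, k d) (k d)!/(dᵏ k!) by the support of the permutation,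
-- every prime q ≠ d dividing n divides each term with k ≥ 1, so H d n ≡ 1 (mod q), and for
-- 0 < j < d the recurrence gives H d (n + j) ≡ H d (n + j - 1) (mod q). So a prime factor of
-- H d n, …, H d (n + d - 1) other than d exceeds m. If there were none, these numbers would all
-- be powers of the prime d; running the recurrence backwards, the smallest one, H d n, divides
-- a product of d - 1 factorials of size about n, whose d-adic valuation is at most
-- (d-1)(n+d-1) by Legendre's formula, contradicting the choice of n.
module Submission where

open import Defs
open import Data.Nat using (ℕ; _≤_; _<_)
open import Data.Nat.Divisibility using (_∣_)
open import Data.Nat.Primality using (Prime)
open import Data.Product using (∃-syntax; _×_)

open import Data.Bool using (true; false; T)
open import Data.Empty using (⊥-elim)
open import Data.Fin as Fin using (toℕ)
open import Data.List using ([]; _∷_; length)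
open import Data.List.Relation.Unary.All using (All; []; _∷_)
open import Data.Nat hiding (_≤_; _<_)
open import Data.Nat.Combinatorics using (_C_; nCk+nC[k+1]≡[n+1]C[k+1]; k>n⇒nCk≡0; nCk≡n!/k![n-k]!; k![n∸k]!∣n!)
open import Data.Nat.Divisibility
open import Data.Nat.DivMod using (m/n*n≡m; m≡m%n+[m/n]*n; m%n<n; m/n<m)
open import Data.Nat.Induction using (<-rec)
open import Data.Nat.ListAction using (product)
open import Data.Nat.Primality
open import Data.Nat.Primality.Factorisation using (factorise)
open import Data.Nat.Properties
open import Data.Nat.Tactic.RingSolver using (solve-∀)
open import Data.Product using (_,_; proj₁; proj₂)
open import Data.Sum using (_⊎_; inj₁; inj₂)
open import Data.Unit using (tt)
open import Data.Vec.Functional using (Vector)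
open import Function using (_∘_; case_of_)
open import Relation.Binary using (tri<; tri≈; tri>)
open import Relation.Binary.PropositionalEquality
open import Relation.Nullary using (¬_; yes; no; contradiction)
open import Algebra.Properties.CommutativeSemigroup *-commutativeSemigroup
  using (x∙yz≈y∙xz; x∙yz≈y∙zx; x∙yz≈yx∙z; xy∙z≈y∙xz; xy∙z≈xz∙y)
open import Algebra.Properties.Semiring.Sum +-*-semiring
  using (sum; sum-syntax; sum-cong-≗; ∑-distrib-+; *-distribˡ-sum; sum-replicate-zero)

m∸n<m : ∀ {m n} → 0 < n → n ≤ m → m ∸ n < m
m∸n<m 0<n n≤m = ∸-monoʳ-< {o = 0} 0<n n≤m

Hfuel-irrelevant : ∀ d .{{_ : NonZero d}} {f g n} → n < f → n < g → Hfuel f d n ≡ Hfuel g d n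
Hfuel-irrelevant d {suc f} {suc g} {n} (s≤s n≤f) (s≤s n≤g) with n <ᵇ d in eq
... | true = refl
... | false = cong₂ (λ a b → a + fall n d * b)
    (Hfuel-irrelevant d (≤-trans n∸1<n n≤f) (≤-trans n∸1<n n≤g))
    (Hfuel-irrelevant d (≤-trans n∸d<n n≤f) (≤-trans n∸d<n n≤g))
  where
  d≤n : d ≤ n
  d≤n = ≮⇒≥ (λ n<d → subst T eq (<⇒<ᵇ n<d))
  n∸1<n : n ∸ 1 < n
  n∸1<n = m∸n<m z<s (≤-trans (>-nonZero⁻¹ d) d≤n)
  n∸d<n : n ∸ d < n
  n∸d<n = m∸n<m (>-nonZero⁻¹ d) d≤n

H-base : ∀ {d n} → n < d → H d n ≡ 1
H-base {d} {n} n<d with n <ᵇ d | <⇒<ᵇ n<d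
... | true | _ = refl

H-rec : ∀ d .{{_ : NonZero d}} {n} → d ≤ n → H d n ≡ H d (n ∸ 1) + fall n d * H d (n ∸ d)
H-rec d {n} d≤n with n <ᵇ d in eq
... | true = ⊥-elim (<⇒≱ (<ᵇ⇒< n d (subst T (sym eq) tt)) d≤n)
... | false = cong₂ (λ a b → a + fall n d * b)
    (Hfuel-irrelevant d (m∸n<m z<s (≤-trans (>-nonZero⁻¹ d) d≤n)) (n<1+n (n ∸ 1)))
    (Hfuel-irrelevant d (m∸n<m (>-nonZero⁻¹ d) d≤n) (n<1+n (n ∸ d)))

H-rec-+ : ∀ d .{{_ : NonZero d}} n → H d (n + d) ≡ H d (n + d ∸ 1) + fall (n + d) d * H d n
H-rec-+ d n = trans (H-rec d (m≤n+m d n)) (cong (λ k → H d (n + d ∸ 1) + fall (n + d) d * H d k) (m+n∸n≡m n d))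

module _ (d : ℕ) .{{_ : NonZero d}} where

  H-mono : ∀ {m n} → m ≤ n → H d m ≤ H d n
  H-mono m≤n = go (≤⇒≤′ m≤n)
    where
    H-mono-suc : ∀ n → H d n ≤ H d (suc n)
    H-mono-suc n with suc n <? d
    ... | yes 1+n<d = ≤-reflexive (trans (H-base (<-trans (n<1+n n) 1+n<d)) (sym (H-base 1+n<d)))
    ... | no 1+n≮d = subst (H d n ≤_) (sym (H-rec d (≮⇒≥ 1+n≮d))) (m≤m+n (H d n) _)
    go : ∀ {m n} → m ≤′ n → H d m ≤ H d n
    go ≤′-refl = ≤-refl
    go (≤′-step m≤′n) = ≤-trans (go m≤′n) (H-mono-suc _)

  H-pos : ∀ n → 1 ≤ H d n
  H-pos n = subst (_≤ H d n) (H-base (>-nonZero⁻¹ d)) (H-mono z≤n)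

fall-pos : ∀ {x k} → k < x → 0 < fall x (suc k)
fall-pos {k = zero} _ = z<s
fall-pos {x} {suc k} k<x = *-mono-≤ (m<n⇒0<n∸m k<x) (fall-pos (<-trans (n<1+n k) k<x))

suc-≤-fall : ∀ c n → suc n ≤ fall (n + suc (suc c)) (suc (suc c))
suc-≤-fall c n = begin
  suc n                                      ≤⟨ m≤m*n (suc n) (fall x (suc c)) {{>-nonZero (fall-pos (≤-trans (n≤1+n (suc c)) (m≤n+m (suc (suc c)) n)))}} ⟩
  suc n * fall x (suc c)                     ≡⟨ cong (_* fall x (suc c)) x∸[1+c]≡1+n ⟨
  (x ∸ suc c) * fall x (suc c)               ∎
  where
  open ≤-Reasoning
  x = n + suc (suc c)
  x∸[1+c]≡1+n : x ∸ suc c ≡ suc n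
  x∸[1+c]≡1+n = trans (cong (_∸ suc c) (+-suc n (suc c))) (m+n∸n≡m (suc n) (suc c))

H-growth : ∀ c n → let d = suc (suc c) in suc n * H d n ≤ H d (n + d)
H-growth c n = begin
  suc n * H d n                               ≤⟨ *-monoˡ-≤ (H d n) (suc-≤-fall c n) ⟩
  fall (n + d) d * H d n                      ≤⟨ m≤n+m _ _ ⟩
  H d (n + d ∸ 1) + fall (n + d) d * H d n   ≡⟨ H-rec-+ d n ⟨
  H d (n + d)                                 ∎
  where
  open ≤-Reasoning
  d = suc (suc c)

n<2^n : ∀ n → n < 2 ^ n
n<2^n zero = z<s
n<2^n (suc n) = +-mono-≤ (m^n>0 2 n) (subst (suc n ≤_) (sym (+-identityʳ (2 ^ n))) (n<2^n n))

-- Start from n₁ = 2Bᴹ · M: every further step of size M multiplies h by at least 2Bᴹ, and after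
-- L = K · B^n₁ steps the factor 2^L beats the L in K · B^(n₁ + L M) = L · (Bᴹ)^L.
superexponential : ∀ (h : ℕ → ℕ) M .{{_ : NonZero M}} → (∀ x → 1 ≤ h x) → (∀ x → suc x * h x ≤ h (x + M)) →
                   ∀ B .{{_ : NonZero B}} K → ∃[ k ] K * B ^ (k * M) < h (k * M)
superexponential h M h-pos h-step B K = a + L , (begin-strict
  K * B ^ ((a + L) * M)          ≡⟨ cong (λ e → K * B ^ e) (*-distribʳ-+ M a L) ⟩
  K * B ^ (a * M + L * M)        ≡⟨ cong (K *_) (^-distribˡ-+-* B (a * M) (L * M)) ⟩
  K * (B ^ (a * M) * B ^ (L * M)) ≡⟨ *-assoc K _ _ ⟨
  L * B ^ (L * M)                ≡⟨ cong (λ e → L * B ^ e) (*-comm L M) ⟩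
  L * B ^ (M * L)                ≡⟨ cong (L *_) (^-*-assoc B M L) ⟨
  L * E ^ L                      <⟨ *-monoˡ-< (E ^ L) {{m^n≢0 E L {{m^n≢0 B M}}}} (n<2^n L) ⟩
  2 ^ L * E ^ L                  ≤⟨ geometric L ⟩
  h ((a + L) * M)                ∎)
  where
  open ≤-Reasoning
  E = B ^ M
  a = 2 * E
  L = K * B ^ (a * M)
  geometric : ∀ j → 2 ^ j * E ^ j ≤ h ((a + j) * M)
  geometric zero = h-pos _
  geometric (suc j) = begin
    2 ^ suc j * E ^ suc j           ≡⟨ [m*n]*[o*p]≡[m*o]*[n*p] 2 (2 ^ j) E (E ^ j) ⟩
    a * (2 ^ j * E ^ j)             ≤⟨ *-mono-≤ a≤1+x (geometric j) ⟩
    suc x * h x                     ≤⟨ h-step x ⟩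
    h (x + M)                       ≡⟨ cong h (+-comm x M) ⟩
    h (suc (a + j) * M)             ≡⟨ cong (λ e → h (e * M)) (+-suc a j) ⟨
    h ((a + suc j) * M)             ∎
    where
    x = (a + j) * M
    a≤1+x : a ≤ suc x
    a≤1+x = ≤-trans (m≤m*n a M) (≤-trans (*-monoˡ-≤ M (m≤m+n a j)) (n≤1+n x))

C-*-factorials : ∀ {n k} → k ≤ n → (n C k) * (k ! * (n ∸ k) !) ≡ n !
C-*-factorials {n} {k} k≤n = trans (cong (_* (k ! * (n ∸ k) !)) (nCk≡n!/k![n-k]! k≤n))
  (m/n*n≡m {{k !* (n ∸ k) !≢0}} (k![n∸k]!∣n! k≤n))

C-absorption : ∀ n k → (suc n C suc k) * suc k ≡ suc n * (n C k)
C-absorption n k with k ≤? n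
... | no k≰n = trans (cong (_* suc k) (k>n⇒nCk≡0 (s≤s (≰⇒> k≰n))))
                     (sym (trans (cong (suc n *_) (k>n⇒nCk≡0 (≰⇒> k≰n))) (*-zeroʳ (suc n))))
... | yes k≤n = *-cancelʳ-≡ _ _ (k ! * (n ∸ k) !) {{k !* (n ∸ k) !≢0}} (begin
  (suc n C suc k) * suc k * (k ! * (n ∸ k) !)   ≡⟨ *-assoc (suc n C suc k) (suc k) _ ⟩
  (suc n C suc k) * (suc k * (k ! * (n ∸ k) !)) ≡⟨ cong ((suc n C suc k) *_) (*-assoc (suc k) (k !) _) ⟨
  (suc n C suc k) * ((suc k) ! * (n ∸ k) !)     ≡⟨ C-*-factorials (s≤s k≤n) ⟩
  (suc n) !                                     ≡⟨ cong (suc n *_) (C-*-factorials k≤n) ⟨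
  suc n * ((n C k) * (k ! * (n ∸ k) !))         ≡⟨ *-assoc (suc n) (n C k) _ ⟨
  suc n * (n C k) * (k ! * (n ∸ k) !)           ∎)
  where open ≡-Reasoning

C-absorptionᵖ : ∀ n k → 0 < k → (n C k) * k ≡ n * (pred n C pred k)
C-absorptionᵖ zero    (suc k) _ = cong (_* suc k) (k>n⇒nCk≡0 {0} {suc k} z<s)
C-absorptionᵖ (suc n) (suc k) _ = C-absorption n k

C-*-fall : ∀ N J m → m ≤ J → (N C J) * fall (suc J) (suc m) ≡ fall (suc N) (suc m) * ((N ∸ m) C (J ∸ m))
C-*-fall N J zero    _   = trans (*-identityʳ (N C J)) (sym (*-identityˡ (N C J)))
C-*-fall N J (suc m) m<J = begin
  (N C J) * ((J ∸ m) * F J)                           ≡⟨ x∙yz≈y∙xz (N C J) (J ∸ m) (F J) ⟩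
  (J ∸ m) * ((N C J) * F J)                           ≡⟨ cong ((J ∸ m) *_) (C-*-fall N J m (<⇒≤ m<J)) ⟩
  (J ∸ m) * (F N * ((N ∸ m) C (J ∸ m)))               ≡⟨ x∙yz≈y∙zx (J ∸ m) (F N) _ ⟩
  F N * (((N ∸ m) C (J ∸ m)) * (J ∸ m))               ≡⟨ cong (F N *_) (C-absorptionᵖ (N ∸ m) (J ∸ m) (m<n⇒0<n∸m m<J)) ⟩
  F N * ((N ∸ m) * (pred (N ∸ m) C pred (J ∸ m)))     ≡⟨ x∙yz≈yx∙z (F N) (N ∸ m) _ ⟩
  (N ∸ m) * F N * (pred (N ∸ m) C pred (J ∸ m))       ≡⟨ cong₂ (λ a b → (N ∸ m) * F N * (a C b)) (pred[m∸n]≡m∸[1+n] N m) (pred[m∸n]≡m∸[1+n] J m) ⟩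
  (N ∸ m) * F N * ((N ∸ suc m) C (J ∸ suc m))         ∎
  where
  open ≡-Reasoning
  F : ℕ → ℕ
  F x = fall (suc x) (suc m)

-- withCycles d n k = C(n, k d) (k d)!/(dᵏ k!) counts the permutations of n points consisting of
-- k d-cycles and fixed points; allCycles d k is the product of the numbers below k d that are
-- not multiples of d, which equals (k d)!/(dᵏ k!).
allCycles : ℕ → ℕ → ℕ
allCycles d zero    = 1
allCycles d (suc k) = fall (suc k * d) d * allCycles d k

withCycles : ℕ → ℕ → ℕ → ℕ
withCycles d n k = (n C (k * d)) * allCycles d k

withCycles-rec : ∀ d .{{_ : NonZero d}} {n} k → d ≤ n →
                 withCycles d n (suc k) ≡ withCycles d (n ∸ 1) (suc k) + fall n d * withCycles d (n ∸ d) k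
withCycles-rec (suc c) {suc n} k _ = begin
  (suc n C suc j) * A                                     ≡⟨ cong (_* A) (nCk+nC[k+1]≡[n+1]C[k+1] n j) ⟨
  ((n C j) + (n C suc j)) * A                             ≡⟨ *-distribʳ-+ A (n C j) (n C suc j) ⟩
  (n C j) * A + (n C suc j) * A                           ≡⟨ +-comm ((n C j) * A) _ ⟩
  (n C suc j) * A + (n C j) * (fall (suc j) d * D k)      ≡⟨ cong ((n C suc j) * A +_) (*-assoc (n C j) _ (D k)) ⟨
  (n C suc j) * A + (n C j) * fall (suc j) d * D k        ≡⟨ cong (λ x → (n C suc j) * A + x * D k) (C-*-fall n j c (m≤m+n c (k * d))) ⟩
  (n C suc j) * A + fall (suc n) d * ((n ∸ c) C (j ∸ c)) * D k
      ≡⟨ cong (λ x → (n C suc j) * A + fall (suc n) d * ((n ∸ c) C x) * D k) (m+n∸m≡n c (k * d)) ⟩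
  (n C suc j) * A + fall (suc n) d * ((n ∸ c) C (k * d)) * D k
      ≡⟨ cong ((n C suc j) * A +_) (*-assoc (fall (suc n) d) _ (D k)) ⟩
  (n C suc j) * A + fall (suc n) d * withCycles d (n ∸ c) k ∎
  where
  open ≡-Reasoning
  d = suc c
  j = c + k * d
  D = allCycles d
  A = D (suc k)

withCycles-small : ∀ d {n} k → n < d → withCycles d n (suc k) ≡ 0
withCycles-small d {n} k n<d = cong (_* allCycles d (suc k)) (k>n⇒nCk≡0 (≤-trans n<d (m≤m+n d (k * d))))

H≡∑withCycles : ∀ d .{{_ : NonZero d}} n B → n < B → H d n ≡ ∑[ k < B ] withCycles d n (toℕ k)
H≡∑withCycles d = <-rec _ step
  where
  open ≡-Reasoning
  step : ∀ n → (∀ {m} → m < n → ∀ B → m < B → H d m ≡ ∑[ k < B ] withCycles d m (toℕ k)) →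
         ∀ B → n < B → H d n ≡ ∑[ k < B ] withCycles d n (toℕ k)
  step n rec (suc B) n<1+B with n <? d
  ... | yes n<d = begin
    H d n                                           ≡⟨ H-base n<d ⟩
    1                                               ≡⟨ cong suc (sum-replicate-zero B) ⟨
    1 + ∑[ k < B ] 0                                ≡⟨ cong suc (sum-cong-≗ {B} (λ k → withCycles-small d (toℕ k) n<d)) ⟨
    1 + ∑[ k < B ] withCycles d n (suc (toℕ k))     ∎
  ... | no n≮d = begin
    H d n                                           ≡⟨ H-rec d d≤n ⟩
    H d (n ∸ 1) + F * H d (n ∸ d)                   ≡⟨ cong₂ (λ x y → x + F * y) (rec n∸1<n (suc B) (<-trans n∸1<n n<1+B))
                                                                                  (rec n∸d<n B (<-≤-trans n∸d<n (s≤s⁻¹ n<1+B))) ⟩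
    1 + sum W₁ + F * sum W₂                         ≡⟨ cong (1 + sum W₁ +_) (*-distribˡ-sum F W₂) ⟩
    1 + sum W₁ + ∑[ k < B ] (F * W₂ k)              ≡⟨ cong suc (∑-distrib-+ W₁ (λ k → F * W₂ k)) ⟨
    1 + ∑[ k < B ] (W₁ k + F * W₂ k)                ≡⟨ cong suc (sum-cong-≗ {B} (λ k → withCycles-rec d (toℕ k) d≤n)) ⟨
    1 + ∑[ k < B ] withCycles d n (suc (toℕ k))     ∎
    where
    d≤n = ≮⇒≥ n≮d
    n∸1<n = m∸n<m z<s (≤-trans (>-nonZero⁻¹ d) d≤n)
    n∸d<n = m∸n<m (>-nonZero⁻¹ d) d≤n
    F = fall n d
    W₁ = λ k → withCycles d (n ∸ 1) (suc (toℕ k))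
    W₂ = λ k → withCycles d (n ∸ d) (toℕ k)

prime∣C : ∀ {q n k} → Prime q → q ∣ n → 0 < k → k < q → q ∣ n C k
prime∣C {q} {n} {k} q-prime q∣n 0<k k<q with euclidsLemma (n C k) k q-prime q∣[nCk]*k
  where
  q∣[nCk]*k : q ∣ (n C k) * k
  q∣[nCk]*k = subst (q ∣_) (sym (C-absorptionᵖ n k 0<k)) (∣m⇒∣m*n _ q∣n)
... | inj₁ q∣nCk = q∣nCk
... | inj₂ q∣k   = contradiction q∣k (>⇒∤ {{>-nonZero 0<k}} k<q)

∸-∣-fall : ∀ x {k s} → 0 < s → s ≤ k → x ∸ s ∣ fall x (suc k)
∸-∣-fall x {zero} {suc s} _ ()
∸-∣-fall x {suc k} {s} 0<s s≤1+k with s ≟ suc k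
... | yes refl    = m∣m*n (fall x (suc k))
... | no  s≢1+k   = ∣n⇒∣m*n (x ∸ suc k) (∸-∣-fall x 0<s (s≤s⁻¹ (≤∧≢⇒< s≤1+k s≢1+k)))

∣-allCycles : ∀ d .{{_ : NonZero d}} {q} k → q < k * d → ¬ d ∣ q → q ∣ allCycles d k
∣-allCycles d@(suc c) {q} (suc k) q<x d∤q with q <? k * d
... | yes q<kd = ∣n⇒∣m*n (fall (suc k * d) d) (∣-allCycles d k q<kd d∤q)
... | no  q≮kd = ∣m⇒∣m*n (allCycles d k) (subst (_∣ fall x d) (m∸[m∸n]≡n (<⇒≤ q<x)) (∸-∣-fall x 0<x∸q x∸q≤c))
  where
  x = suc k * d
  kd<q : k * d < q
  kd<q = ≤∧≢⇒< (≮⇒≥ q≮kd) (λ kd≡q → d∤q (divides k (sym kd≡q)))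
  0<x∸q : 0 < x ∸ q
  0<x∸q = m<n⇒0<n∸m q<x
  x∸q≤c : x ∸ q ≤ c
  x∸q≤c = s≤s⁻¹ (subst (x ∸ q <_) (m+n∸n≡m d (k * d)) (∸-monoʳ-< kd<q (<⇒≤ q<x)))

∣-withCycles : ∀ d .{{_ : NonZero d}} {q n} k → Prime q → ¬ d ∣ q → q ∣ n → q ∣ withCycles d n (suc k)
∣-withCycles d {q} {n} k q-prime d∤q q∣n with q <? suc k * d
... | yes q<j = ∣n⇒∣m*n (n C (suc k * d)) (∣-allCycles d (suc k) q<j d∤q)
... | no  q≮j = ∣m⇒∣m*n (allCycles d (suc k)) (prime∣C q-prime q∣n (≤-trans (>-nonZero⁻¹ d) (m≤m+n d (k * d))) j<q)
  where
  j<q : suc k * d < q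
  j<q = ≤∧≢⇒< (≮⇒≥ q≮j) (λ j≡q → d∤q (divides (suc k) (sym j≡q)))

∣-sum : ∀ {q n} (f : Vector ℕ n) → (∀ i → q ∣ f i) → q ∣ sum f
∣-sum {n = zero}  f q∣f = _ ∣0
∣-sum {n = suc n} f q∣f = ∣m∣n⇒∣m+n (q∣f Fin.zero) (∣-sum (f ∘ Fin.suc) (q∣f ∘ Fin.suc))

prime⇒∤1 : ∀ {q} → Prime q → ¬ q ∣ 1
prime⇒∤1 q-prime q∣1 = nonTrivial⇒≢1 {{prime⇒nonTrivial q-prime}} (∣1⇒≡1 q∣1)

∤-H : ∀ d .{{_ : NonZero d}} {q n} → Prime q → ¬ d ∣ q → q ∣ n → ¬ q ∣ H d n
∤-H d {q} {n} q-prime d∤q q∣n q∣H = prime⇒∤1 q-prime (∣m+n∣m⇒∣n (subst (q ∣_) (+-comm 1 X) q∣1+X) q∣X)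
  where
  X = ∑[ k < n ] withCycles d n (suc (toℕ k))
  q∣1+X : q ∣ 1 + X
  q∣1+X = subst (q ∣_) (H≡∑withCycles d n (suc n) (n<1+n n)) q∣H
  q∣X : q ∣ X
  q∣X = ∣-sum {n = n} _ (λ k → ∣-withCycles d (toℕ k) q-prime d∤q q∣n)

∤-H-window : ∀ d .{{_ : NonZero d}} {q n j} → Prime q → ¬ d ∣ q → q ∣ n → j < d → ¬ q ∣ H d (n + j)
∤-H-window d {n = n} {zero} q-prime d∤q q∣n _ = subst (λ m → ¬ _ ∣ H d m) (sym (+-identityʳ n)) (∤-H d q-prime d∤q q∣n)
∤-H-window d@(suc c) {q} {n} {suc j} q-prime d∤q q∣n 1+j<d q∣H with d ≤? n + suc j
... | no  d≰x = prime⇒∤1 q-prime (subst (q ∣_) (H-base (≰⇒> d≰x)) q∣H)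
... | yes d≤x = ∤-H-window d q-prime d∤q q∣n (<-trans (n<1+n j) 1+j<d) q∣H[n+j]
  where
  x = n + suc j
  q∣fall : q ∣ fall x d
  q∣fall = ∣-trans q∣n (subst (_∣ fall x d) (m+n∸n≡m n (suc j)) (∸-∣-fall x z<s (s≤s⁻¹ 1+j<d)))
  q∣H[n+j] : q ∣ H d (n + j)
  q∣H[n+j] = subst (λ m → q ∣ H d m) (cong pred (+-suc n j))
    (∣m+n∣m⇒∣n (subst (q ∣_) (trans (H-rec d d≤x) (+-comm (H d (x ∸ 1)) _)) q∣H) (∣m⇒∣m*n (H d (x ∸ d)) q∣fall))

^-monoʳ-∣ : ∀ b {m n} → m ≤ n → b ^ m ∣ b ^ n
^-monoʳ-∣ b {m} {n} m≤n = divides (b ^ (n ∸ m)) (begin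
  b ^ n                ≡⟨ cong (b ^_) (m+[n∸m]≡n m≤n) ⟨
  b ^ (m + (n ∸ m))    ≡⟨ ^-distribˡ-+-* b m (n ∸ m) ⟩
  b ^ m * b ^ (n ∸ m)  ≡⟨ *-comm (b ^ m) _ ⟩
  b ^ (n ∸ m) * b ^ m  ∎)
  where open ≡-Reasoning

superfactorial : ℕ → ℕ → ℕ
superfactorial a zero    = 1
superfactorial a (suc b) = a ! * superfactorial (suc a) b

superfactorial-snoc : ∀ a b → superfactorial a (suc b) ≡ superfactorial a b * (a + b) !
superfactorial-snoc a zero    = trans (*-identityʳ (a !)) (trans (cong _! (sym (+-identityʳ a))) (sym (*-identityˡ _)))
superfactorial-snoc a (suc b) = begin
  a ! * superfactorial (suc a) (suc b)           ≡⟨ cong (a ! *_) (superfactorial-snoc (suc a) b) ⟩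
  a ! * (superfactorial (suc a) b * (suc a + b) !) ≡⟨ *-assoc (a !) _ _ ⟨
  a ! * superfactorial (suc a) b * (suc a + b) !   ≡⟨ cong (λ x → superfactorial a (suc b) * x !) (+-suc a b) ⟨
  superfactorial a (suc b) * (a + suc b) !         ∎
  where open ≡-Reasoning

record ValuationAtMost (p b x : ℕ) : Set where
  constructor valuation≤
  field
    v u           : ℕ
    x≡pᵛ*u        : x ≡ p ^ v * u
    p∤u           : ¬ p ∣ u
    v≤b           : v ≤ b

module _ {p} (p-prime : Prime p) where

  ∤-* : ∀ {x y} → ¬ p ∣ x → ¬ p ∣ y → ¬ p ∣ x * y
  ∤-* {x} {y} p∤x p∤y p∣xy with euclidsLemma x y p-prime p∣xy
  ... | inj₁ p∣x = p∤x p∣x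
  ... | inj₂ p∣y = p∤y p∣y

  private
    instance
      p≢0 : NonZero p
      p≢0 = prime⇒nonZero p-prime
    1+pred[p]≡p : suc (pred p) ≡ p
    1+pred[p]≡p = suc-pred p
    pred[p]<p : pred p < p
    pred[p]<p = subst (pred p <_) 1+pred[p]≡p (n<1+n (pred p))

  -- The factors of (r + a p)! divisible by p are p, 2p, …, a p.
  factorial-block : ∀ a r → r < p → ∃[ u ] ((r + a * p) ! ≡ p ^ a * a ! * u × ¬ p ∣ u)
  factorial-block zero    zero    _ = 1 , refl , prime⇒∤1 p-prime
  factorial-block (suc a) zero    _ with factorial-block a (pred p) pred[p]<p
  ... | u , eq , p∤u = u , (begin
    (p + a * p) !                         ≡⟨ cong (λ x → (x + a * p) !) 1+pred[p]≡p ⟨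
    suc (pred p + a * p) !                ≡⟨ cong₂ (λ x y → (x + a * p) * y) 1+pred[p]≡p eq ⟩
    suc a * p * (p ^ a * a ! * u)         ≡⟨ rearrange (suc a) p (p ^ a) (a !) u ⟩
    p ^ suc a * (suc a) ! * u             ∎) , p∤u
    where
    open ≡-Reasoning
    rearrange : ∀ s x y z u → s * x * (y * z * u) ≡ x * y * (s * z) * u
    rearrange = solve-∀
  factorial-block a (suc r) 1+r<p with factorial-block a r (<-trans (n<1+n r) 1+r<p)
  ... | u , eq , p∤u = suc (r + a * p) * u , (begin
    suc (r + a * p) * (r + a * p) !          ≡⟨ cong (suc (r + a * p) *_) eq ⟩
    suc (r + a * p) * (p ^ a * a ! * u)      ≡⟨ x∙yz≈y∙xz (suc (r + a * p)) (p ^ a * a !) u ⟩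
    p ^ a * a ! * (suc (r + a * p) * u)      ∎) , ∤-* p∤1+r+ap p∤u
    where
    open ≡-Reasoning
    p∤1+r+ap : ¬ p ∣ suc (r + a * p)
    p∤1+r+ap p∣ = >⇒∤ 1+r<p (∣m+n∣m⇒∣n (subst (p ∣_) (+-comm (suc r) (a * p)) p∣) (n∣m*n a))

  valuation≤-p^ : ∀ a → ValuationAtMost p a (p ^ a)
  valuation≤-p^ a = valuation≤ a 1 (sym (*-identityʳ (p ^ a))) (prime⇒∤1 p-prime) ≤-refl

  valuation≤-∤ : ∀ {u} → ¬ p ∣ u → ValuationAtMost p 0 u
  valuation≤-∤ {u} p∤u = valuation≤ 0 u (sym (+-identityʳ u)) p∤u z≤n

  valuation≤-* : ∀ {a b x y} → ValuationAtMost p a x → ValuationAtMost p b y → ValuationAtMost p (a + b) (x * y)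
  valuation≤-* {x = x} {y} (valuation≤ v u x≡ p∤u v≤a) (valuation≤ v′ u′ y≡ p∤u′ v′≤b) =
    valuation≤ (v + v′) (u * u′) (begin
      x * y                         ≡⟨ cong₂ _*_ x≡ y≡ ⟩
      p ^ v * u * (p ^ v′ * u′)     ≡⟨ [m*n]*[o*p]≡[m*o]*[n*p] (p ^ v) u (p ^ v′) u′ ⟩
      p ^ v * p ^ v′ * (u * u′)     ≡⟨ cong (_* (u * u′)) (^-distribˡ-+-* p v v′) ⟨
      p ^ (v + v′) * (u * u′)       ∎) (∤-* p∤u p∤u′) (+-mono-≤ v≤a v′≤b)
    where open ≡-Reasoning

  valuation≤-mono : ∀ {a b x} → a ≤ b → ValuationAtMost p a x → ValuationAtMost p b x
  valuation≤-mono a≤b (valuation≤ v u x≡ p∤u v≤a) = valuation≤ v u x≡ p∤u (≤-trans v≤a a≤b)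

  -- Legendre: v_p(N!) = ⌊N/p⌋ + v_p(⌊N/p⌋!) ≤ 2⌊N/p⌋ ≤ N.
  valuation≤-! : ∀ N → ValuationAtMost p N (N !)
  valuation≤-! = <-rec _ step
    where
    step : ∀ N → (∀ {M} → M < N → ValuationAtMost p M (M !)) → ValuationAtMost p N (N !)
    step zero    _   = valuation≤-∤ (prime⇒∤1 p-prime)
    step N@(suc _) rec with factorial-block (N / p) (N % p) (m%n<n N p)
    ... | u , N!≡ , p∤u = valuation≤-mono a+a+0≤N
      (subst (ValuationAtMost p _) (trans (sym N!≡) (cong _! (sym (m≡m%n+[m/n]*n N p))))
        (valuation≤-* (valuation≤-* (valuation≤-p^ a) (rec (m/n<m N p 1<p))) (valuation≤-∤ p∤u)))
      where
      1<p = nonTrivial⇒n>1 p {{prime⇒nonTrivial p-prime}}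
      a = N / p
      a+a+0≤N : a + a + 0 ≤ N
      a+a+0≤N = begin
        a + a + 0   ≡⟨ +-identityʳ (a + a) ⟩
        a + a       ≡⟨ cong (a +_) (+-identityʳ a) ⟨
        2 * a       ≡⟨ *-comm 2 a ⟩
        a * 2       ≤⟨ *-monoʳ-≤ a 1<p ⟩
        a * p       ≤⟨ m≤n+m (a * p) (N % p) ⟩
        N % p + a * p ≡⟨ m≡m%n+[m/n]*n N p ⟨
        N           ∎
        where open ≤-Reasoning

  pow∣⇒≤valuation : ∀ {b x f} → ValuationAtMost p b x → p ^ f ∣ x → f ≤ b
  pow∣⇒≤valuation {f = f} (valuation≤ v u x≡ p∤u v≤b) pᶠ∣x with f ≤? v
  ... | yes f≤v = ≤-trans f≤v v≤b
  ... | no  f≰v = contradiction (*-cancelˡ-∣ (p ^ v) {{m^n≢0 p v}} pᵛp∣pᵛu) p∤u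
    where
    pᵛp∣pᵛu : p ^ v * p ∣ p ^ v * u
    pᵛp∣pᵛu = subst₂ _∣_ (*-comm p (p ^ v)) x≡ (∣-trans (^-monoʳ-∣ p (≰⇒> f≰v)) pᶠ∣x)

  valuation≤-superfactorial : ∀ a b → ValuationAtMost p (b * (a + b)) (superfactorial a b)
  valuation≤-superfactorial a zero    = valuation≤-∤ (prime⇒∤1 p-prime)
  valuation≤-superfactorial a (suc b) = valuation≤-mono bound
    (valuation≤-* (valuation≤-! a) (valuation≤-superfactorial (suc a) b))
    where
    bound : a + b * (suc a + b) ≤ suc b * (a + suc b)
    bound = +-mono-≤ (m≤m+n a (suc b)) (≤-reflexive (cong (b *_) (sym (+-suc a b))))

fall-*-! : ∀ n k → fall (n + suc k) (suc k) * n ! ≡ (n + k) !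
fall-*-! n zero    = trans (+-identityʳ (n !)) (cong _! (sym (+-identityʳ n)))
fall-*-! n (suc k) = begin
  (x ∸ suc k) * fall x (suc k) * n !          ≡⟨ cong (λ y → y * fall x (suc k) * n !) x∸[1+k]≡1+n ⟩
  suc n * fall x (suc k) * n !                ≡⟨ xy∙z≈y∙xz (suc n) (fall x (suc k)) (n !) ⟩
  fall x (suc k) * (suc n) !                  ≡⟨ cong (λ y → fall y (suc k) * (suc n) !) (+-suc n (suc k)) ⟩
  fall (suc n + suc k) (suc k) * (suc n) !    ≡⟨ fall-*-! (suc n) k ⟩
  (suc n + k) !                               ≡⟨ cong _! (+-suc n k) ⟨
  (n + suc k) !                               ∎
  where
  open ≡-Reasoning
  x = n + suc (suc k)
  x∸[1+k]≡1+n : x ∸ suc k ≡ suc n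
  x∸[1+k]≡1+n = trans (cong (_∸ suc k) (+-suc n (suc k))) (m+n∸n≡m (suc n) (suc k))

fallProduct : ℕ → ℕ → ℕ
fallProduct d zero    = 1
fallProduct d (suc n) = fall (n + d) d * fallProduct d n

fallProduct-telescopes : ∀ c n → fallProduct (suc c) n * superfactorial 0 c ≡ superfactorial n c
fallProduct-telescopes c zero    = *-identityˡ (superfactorial 0 c)
fallProduct-telescopes c (suc n) = begin
  F * fallProduct (suc c) n * superfactorial 0 c   ≡⟨ *-assoc F _ _ ⟩
  F * (fallProduct (suc c) n * superfactorial 0 c) ≡⟨ cong (F *_) (fallProduct-telescopes c n) ⟩
  F * superfactorial n c                           ≡⟨ *-cancelʳ-≡ _ _ (n !) {{n !≢0}} F*sf[n]*n!≡sf[1+n]*n! ⟩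
  superfactorial (suc n) c                         ∎
  where
  open ≡-Reasoning
  F = fall (n + suc c) (suc c)
  F*sf[n]*n!≡sf[1+n]*n! : F * superfactorial n c * n ! ≡ superfactorial (suc n) c * n !
  F*sf[n]*n!≡sf[1+n]*n! = begin
    F * superfactorial n c * n !       ≡⟨ xy∙z≈y∙xz F (superfactorial n c) (n !) ⟩
    superfactorial n c * (F * n !)     ≡⟨ cong (superfactorial n c *_) (fall-*-! n c) ⟩
    superfactorial n c * (n + c) !     ≡⟨ superfactorial-snoc n c ⟨
    n ! * superfactorial (suc n) c     ≡⟨ *-comm (n !) _ ⟩
    superfactorial (suc n) c * n !     ∎

-- c accumulates the coefficients fall (n + d) d picked up while descending to H d 0 = 1.
∣-fallProduct : ∀ e {x} n c → let d = suc (suc e) in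
                (∀ j → j < d → x ∣ c * H d (n + j)) → x ∣ c * fallProduct d n
∣-fallProduct e {x} zero c x∣cH = subst (λ y → x ∣ c * y) (H-base {suc (suc e)} z<s) (x∣cH 0 z<s)
∣-fallProduct e {x} (suc n) c x∣cH =
  subst (x ∣_) (*-assoc c F (fallProduct d n)) (∣-fallProduct e n (c * F) x∣cFH)
  where
  d = suc (suc e)
  F = fall (n + d) d
  x∣cH[n+d] : x ∣ c * H d (n + d)
  x∣cH[n+d] = subst (λ y → x ∣ c * H d y) (sym (+-suc n (suc e))) (x∣cH (suc e) ≤-refl)
  x∣cH[n+d∸1] : x ∣ c * H d (n + d ∸ 1)
  x∣cH[n+d∸1] = subst (λ y → x ∣ c * H d y) (sym (trans (cong (_∸ 1) (+-suc n (suc e))) (+-suc n e)))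
                      (x∣cH e (<-trans (n<1+n e) (n<1+n (suc e))))
  x∣cFH : ∀ j → j < d → x ∣ c * F * H d (n + j)
  x∣cFH zero    _     = subst (x ∣_) (trans (sym (*-assoc c F (H d n))) (cong (λ y → c * F * H d y) (sym (+-identityʳ n))))
    (∣m+n∣m⇒∣n (subst (x ∣_) (trans (cong (c *_) (H-rec-+ d n)) (*-distribˡ-+ c _ _)) x∣cH[n+d]) x∣cH[n+d∸1])
  x∣cFH (suc j) 1+j<d = subst (x ∣_) (trans (xy∙z≈xz∙y c (H d (suc n + j)) F) (cong (λ y → c * F * H d y) (sym (+-suc n j))))
    (∣m⇒∣m*n F (x∣cH j (<-trans (n<1+n j) 1+j<d)))

^-cancelʳ-≤ : ∀ b → 1 < b → ∀ {m n} → b ^ m ≤ b ^ n → m ≤ n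
^-cancelʳ-≤ b 1<b bᵐ≤bⁿ = ≮⇒≥ (λ n<m → <⇒≱ (^-monoʳ-< b 1<b n<m) bᵐ≤bⁿ)

H-powers-bound : ∀ e n → let d = suc (suc e) in Prime d →
                 (∀ j → j < d → ∃[ f ] H d (n + j) ≡ d ^ f) → H d n ≤ d ^ (suc e * (n + suc e))
H-powers-bound e n d-prime powers = begin
  H d n          ≡⟨ cong (H d) (+-identityʳ n) ⟨
  H d (n + 0)    ≡⟨ H[n]≡dᶠ ⟩
  d ^ f          ≤⟨ ^-monoʳ-≤ d {f} (pow∣⇒≤valuation d-prime (valuation≤-superfactorial d-prime n (suc e)) dᶠ∣sf) ⟩
  d ^ (suc e * (n + suc e)) ∎
  where
  open ≤-Reasoning
  d = suc (suc e)
  f = proj₁ (powers 0 z<s)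
  H[n]≡dᶠ = proj₂ (powers 0 z<s)
  dᶠ∣H : ∀ j → j < d → d ^ f ∣ 1 * H d (n + j)
  dᶠ∣H j j<d with powers j j<d
  ... | g , H[n+j]≡dᵍ = subst (d ^ f ∣_) (sym (trans (+-identityʳ _) H[n+j]≡dᵍ)) (^-monoʳ-∣ d (^-cancelʳ-≤ d (s≤s (s≤s z≤n)) {f} {g}
        (subst₂ _≤_ H[n]≡dᶠ H[n+j]≡dᵍ (H-mono d (+-monoʳ-≤ n z≤n)))))
  dᶠ∣sf : d ^ f ∣ superfactorial n (suc e)
  dᶠ∣sf = subst (d ^ f ∣_) (fallProduct-telescopes (suc e) n)
            (∣m⇒∣m*n (superfactorial 0 (suc e)) (subst (d ^ f ∣_) (+-identityʳ _) (∣-fallProduct e n 1 dᶠ∣H)))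

module _ (d : ℕ) where

  product-all≡ : ∀ {ps} → All (_≡ d) ps → product ps ≡ d ^ length ps
  product-all≡ []            = refl
  product-all≡ (refl ∷ ps≡d) = cong (d *_) (product-all≡ ps≡d)

  prime-factor≢⊎all≡ : ∀ {ps} → All Prime ps → (∃[ p ] Prime p × p ∣ product ps × p ≢ d) ⊎ All (_≡ d) ps
  prime-factor≢⊎all≡ [] = inj₂ []
  prime-factor≢⊎all≡ {p ∷ _} (p-prime ∷ ps-prime) with p ≟ d | prime-factor≢⊎all≡ ps-prime
  ... | no  p≢d | _                                 = inj₁ (p , p-prime , m∣m*n _ , p≢d)
  ... | yes _   | inj₁ (q , q-prime , q∣∏ps , q≢d) = inj₁ (q , q-prime , ∣n⇒∣m*n p q∣∏ps , q≢d)
  ... | yes p≡d | inj₂ ps≡d                         = inj₂ (p≡d ∷ ps≡d)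

  prime-factor≢⊎power : ∀ {x} → 2 ≤ x → (∃[ p ] Prime p × p ∣ x × p ≢ d) ⊎ (Prime d × ∃[ f ] x ≡ d ^ f)
  prime-factor≢⊎power {x@(suc _)} 2≤x with factorise x
  ... | record { isFactorisation = x≡∏ps ; factorsPrime = ps-prime } =
    subst (λ y → (∃[ p ] Prime p × p ∣ y × p ≢ d) ⊎ (Prime d × ∃[ f ] y ≡ d ^ f)) (sym x≡∏ps)
          (of-product ps-prime (subst (2 ≤_) x≡∏ps 2≤x))
    where
    of-product : ∀ {ps} → All Prime ps → 2 ≤ product ps →
                 (∃[ p ] Prime p × p ∣ product ps × p ≢ d) ⊎ (Prime d × ∃[ f ] product ps ≡ d ^ f)
    of-product {ps} ps-prime 2≤∏ps with prime-factor≢⊎all≡ ps-prime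
    ... | inj₁ factor≢d = inj₁ factor≢d
    of-product {ps} (p-prime ∷ _) _ | inj₂ ps≡d@(refl ∷ _) = inj₂ (p-prime , length ps , product-all≡ ps≡d)
    of-product [] (s≤s ()) | inj₂ []

bounded-⊎ : ∀ {P Q : ℕ → Set} b → (∀ j → j < b → P j ⊎ Q j) → (∃[ j ] j < b × P j) ⊎ (∀ j → j < b → Q j)
bounded-⊎ zero    _     = inj₂ λ _ ()
bounded-⊎ (suc b) P⊎Q with bounded-⊎ b (λ j j<b → P⊎Q j (<-trans j<b (n<1+n b))) | P⊎Q b (n<1+n b)
... | inj₁ (j , j<b , Pj) | _      = inj₁ (j , <-trans j<b (n<1+n b) , Pj)
... | inj₂ _             | inj₁ Pb = inj₁ (b , n<1+n b , Pb)
... | inj₂ Q<b           | inj₂ Qb = inj₂ λ j j<1+b → case <-cmp j b of λ where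
  (tri< j<b _ _) → Q<b j j<b
  (tri≈ _ refl _) → Qb
  (tri> _ _ j>b) → contradiction j<1+b (<⇒≱ (s≤s j>b))

m≤n⇒m∣n! : ∀ {m n} .{{_ : NonZero m}} → m ≤ n → m ∣ n !
m≤n⇒m∣n! {suc m} m≤n = ∣-trans (m∣m*n (m !)) (m≤n⇒m!∣n! m≤n)

prime-factor-beyond : ∀ d .{{_ : NonZero d}} {m n p j} → 1 < d → m ! ∣ n → j < d →
                      Prime p → p ≢ d → p ∣ H d (n + j) → m < p
prime-factor-beyond d {m} {n} {p} 1<d m!∣n j<d p-prime p≢d p∣H = ≰⇒> λ p≤m →
  ∤-H-window d p-prime d∤p (∣-trans (m≤n⇒m∣n! {{prime⇒nonZero p-prime}} p≤m) m!∣n) j<d p∣H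
  where
  d∤p : ¬ d ∣ p
  d∤p d∣p with prime⇒irreducible p-prime d∣p
  ... | inj₁ d≡1 = <⇒≢ 1<d (sym d≡1)
  ... | inj₂ d≡p = p≢d (sym d≡p)

H-large : ∀ e m → let d = suc (suc e) in ∃[ n ] (m ! ∣ n × d ^ (suc e * (n + suc e)) < H d n)
H-large e m = n , ∣-trans (m∣m*n d) (n∣m*n k) , subst (_< H d n) (sym dᶜ⁽ⁿ⁺ᶜ⁾≡) (proj₂ grown)
  where
  d = suc (suc e)
  c = suc e
  M = m ! * d
  instance _ = m*n≢0 (m !) d {{m !≢0}}
  H-growth-M : ∀ x → suc x * H d x ≤ H d (x + M)
  H-growth-M x = ≤-trans (H-growth e x) (H-mono d (+-monoʳ-≤ x (m≤n*m d (m !) {{m !≢0}})))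
  grown = superexponential (H d) M (H-pos d) H-growth-M (d ^ c) {{m^n≢0 d c}} (d ^ (c * c))
  k = proj₁ grown
  n = k * M
  dᶜ⁽ⁿ⁺ᶜ⁾≡ : d ^ (c * (n + c)) ≡ d ^ (c * c) * (d ^ c) ^ n
  dᶜ⁽ⁿ⁺ᶜ⁾≡ = begin
    d ^ (c * (n + c))             ≡⟨ cong (d ^_) (*-distribˡ-+ c n c) ⟩
    d ^ (c * n + c * c)           ≡⟨ ^-distribˡ-+-* d (c * n) (c * c) ⟩
    d ^ (c * n) * d ^ (c * c)     ≡⟨ *-comm (d ^ (c * n)) _ ⟩
    d ^ (c * c) * d ^ (c * n)     ≡⟨ cong (d ^ (c * c) *_) (^-*-assoc d c n) ⟨
    d ^ (c * c) * (d ^ c) ^ n     ∎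
    where open ≡-Reasoning

mainTheorem10 : ∀ (d : ℕ) → 2 ≤ d →
    ∀ (m : ℕ) → ∃[ p ] (m < p × Prime p × ∃[ n ] (p ∣ H d n))
mainTheorem10 d@(suc (suc e)) 1<d m with H-large e m
... | n , m!∣n , large with bounded-⊎ d (λ j _ → prime-factor≢⊎power d (2≤H[n+] j))
  where
  2≤H[n+] : ∀ j → 2 ≤ H d (n + j)
  2≤H[n+] j = ≤-trans (s≤s (m^n>0 d (suc e * (n + suc e)))) (≤-trans large (H-mono d (m≤m+n n j)))
...   | inj₁ (j , j<d , p , p-prime , p∣H , p≢d) =
  p , prime-factor-beyond d 1<d m!∣n j<d p-prime p≢d p∣H , p-prime , n + j , p∣H
...   | inj₂ powers =
  contradiction (H-powers-bound e n (proj₁ (powers 0 z<s)) (λ j j<d → proj₂ (powers j j<d))) (<⇒≱ large)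
mainTheorem10 1 (s≤s ())
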